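{- Let $n\ge 2$ and $0\le m\le\binom n2-1$. If there exists a matrix $\rho_{n,m}$ (rows indexed by $\mathcal X(n,m)$, columns by $\mathcal X(n,m+1)$, nonnegative entries) satisfying: every row sum is $1$; $\frac{1}{s(n,m)}\sum_{\boldsymbol x}\rho_{n,m}(\boldsymbol x,\boldsymbol y)=\frac{1}{s(n,m+1)}$ for every column $\boldsymbol y$; and $\rho_{n,m}(\boldsymbol x,\boldsymbol y)=0$ whenever $\boldsymbol y$ does not cover $\boldsymbol x$ — then a matrix $\rho_{n,\tilde m}$ with the same properties (with $m$ replaced by $\tilde m$) exists for $\tilde m=\binom n2-1-m$.
   Context: $\mathcal X(n,m)$ is the set of integer sequences $\boldsymbol x=x_1\cdots x_n$ with $0\le x_i\le i-1$ and $\sum x_i=m$; $s(n,m)=|\mathcal X(n,m)|$. For $\boldsymbol x\in\mathcal X(n,m)$, $\boldsymbol y\in\mathcal X(n,m+1)$, $\boldsymbol y$ covers $\boldsymbol x$ if there is $j$ with $y_j=x_j+1$ and $y_i=x_i$ for $i\ne j$.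
   Formalization: The matrices $\rho_{n,m}$ and $\rho_{n,\tilde m}$ have rational entries. -}

module Defs where

open import Data.Nat as ℕ using (ℕ; zero; suc; _≟_)
open import Data.Fin using (Fin)
import Data.Integer
open import Data.Vec as Vec using (Vec; []; _∷_; _∷ʳ_; lookup)
open import Data.List as List using (List; []; _∷_; concatMap; filter; upTo; length; foldr)
open import Data.List.Membership.Propositional using (_∈_)
open import Data.Rational as ℚ using (ℚ; 0ℚ; 1ℚ; _+_; _*_; _≤_)
open import Data.Product using (Σ; _×_)
open import Relation.Binary.PropositionalEquality using (_≡_; _≢_)
open import Relation.Nullary using (¬_)

-- All integer sequences x₁⋯xₙ with 0 ≤ xᵢ ≤ i-1 (1-based index i),
-- enumerated by appending the last entry xₙ ∈ {0,…,n-1}.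
invSeqs : (n : ℕ) → List (Vec ℕ n)
invSeqs zero    = [] ∷ []
invSeqs (suc n) = concatMap (λ v → List.map (λ k → v ∷ʳ k) (upTo (suc n))) (invSeqs n)

𝒳 : (n : ℕ) → ℕ → List (Vec ℕ n)
𝒳 n m = filter (λ x → Vec.sum x ≟ m) (invSeqs n)

s : ℕ → ℕ → ℕ
s n m = length (𝒳 n m)

Covers : {n : ℕ} → Vec ℕ n → Vec ℕ n → Set
Covers {n} x y = Σ (Fin n) λ j → (lookup y j ≡ suc (lookup x j)) × (∀ i → i ≢ j → lookup y i ≡ lookup x i)

Σ[_]_ : {A : Set} → List A → (A → ℚ) → ℚ
Σ[ xs ] f = foldr (λ a r → f a + r) 0ℚ xs

ι : ℕ → ℚ
ι k = Data.Integer.+ k ℚ./ 1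

-- ρ is a matrix with rows 𝒳(n,m), columns 𝒳(n,m+1) (entries outside are irrelevant)
-- satisfying the three properties of the paper.
IsTransition : (n m : ℕ) → (Vec ℕ n → Vec ℕ n → ℚ) → Set
IsTransition n m ρ =
  (∀ x y → x ∈ 𝒳 n m → y ∈ 𝒳 n (suc m) → 0ℚ ≤ ρ x y)
  × (∀ x → x ∈ 𝒳 n m → Σ[ 𝒳 n (suc m) ] (λ y → ρ x y) ≡ 1ℚ)
  -- (1/s(n,m)) ∑ₓ ρ(x,y) = 1/s(n,m+1), cross-multiplied
  × (∀ y → y ∈ 𝒳 n (suc m) → Σ[ 𝒳 n m ] (λ x → ρ x y) * ι (s n (suc m)) ≡ ι (s n m))
  × (∀ x y → x ∈ 𝒳 n m → y ∈ 𝒳 n (suc m) → ¬ Covers x y → ρ x y ≡ 0ℚ)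

HasTransition : ℕ → ℕ → Set
HasTransition n m = Σ (Vec ℕ n → Vec ℕ n → ℚ) (IsTransition n m)

module Submission where

-- The complement of an inversion sequence x = x₁⋯xₙ is x̄ with x̄ᵢ = (i-1) - xᵢ.
-- It is an involution of the set of all inversion sequences, it sends 𝒳(n,a)
-- onto 𝒳(n,b) whenever a + b = C(n,2), and it turns covers around: if x̄
-- covers ȳ then y covers x.  Given a transition matrix ρ for level m, the matrix
--   ρ̃(x,y) = ρ(ȳ,x̄) · s(n,m+1)/s(n,m)
-- is therefore a transition matrix for level m̃ = C(n,2)-1-m: its row sums are
-- the (rescaled) column sums of ρ and vice versa, using s(n,m̃) = s(n,m+1) and
-- s(n,m̃+1) = s(n,m).

open import Defs
open import Algebra.Bundles using (CommutativeMonoid)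
open import Data.Nat as ℕ using (ℕ; zero; suc; _+_; _∸_; _⊓_; _≤_; z≤n; s≤s; _≟_)
open import Data.Nat.Properties
  using (+-comm; +-suc; +-assoc; +-identityʳ; +-cancelˡ-≡; +-commutativeSemigroup; ≤-trans; m≤n+m; n≤1+n; m⊓n≤m;
         m∸n≤m; m∸n+n≡m; m+[n∸m]≡n; m+n∸m≡n; m∸[m∸n]≡n; ∸-monoˡ-≤; ∸-cancelˡ-≡; m⊓n+n∸m≡n)
open import Data.Nat.Combinatorics using (_C_; nC1≡n; nCk+nC[k+1]≡[n+1]C[k+1])
open import Data.Fin using (Fin; toℕ) renaming (zero to fzero; suc to fsuc)
open import Data.Vec as Vec using (Vec; []; _∷_; _∷ʳ_; lookup)
open import Data.List as List using (List; []; _∷_; [_]; map; concatMap; filter; reverse; upTo; downFrom; length; foldr)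
open import Data.List.Properties
  using (map-∘; map-cong; map-upTo; length-map; foldr-map; reverse-map; reverse-upTo; unfold-reverse;
         concatMap-cong; concatMap-map; map-concatMap; concatMap-++; ++-identityʳ; reverse-++)
open import Data.List.Relation.Unary.Any using (here; there)
open import Data.List.Membership.Propositional using (_∈_; find; lose)
open import Data.List.Membership.Propositional.Properties
  using (∈-map⁺; ∈-map⁻; ∈-concatMap⁺; ∈-concatMap⁻; ∈-upTo⁺; ∈-upTo⁻; ∈-filter⁺; ∈-filter⁻)
open import Data.List.Relation.Binary.Permutation.Propositional using (_↭_; ↭⇒↭ₛ)
open import Data.List.Relation.Binary.Permutation.Propositional.Properties
  using (map⁺; ↭-length; ↭-reverse; filter-↭; ∈-resp-↭)
open import Data.List.Relation.Binary.Permutation.Setoid.Properties using (foldr-commMonoid)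
open import Data.Product using (∃; _×_; _,_; proj₁; proj₂)
open import Data.Empty using (⊥-elim)
open import Data.Rational as ℚ using (ℚ; 0ℚ; 1ℚ; 1/_)
import Data.Rational.Properties as ℚP
open import Algebra.Properties.CommutativeSemigroup +-commutativeSemigroup using (interchange)
open import Function using (_∘_)
open import Relation.Nullary using (¬_; yes; no)
open import Relation.Unary using (Decidable)
open import Relation.Binary.PropositionalEquality hiding ([_])
open ≡-Reasoning

C2-suc : (n : ℕ) → suc n C 2 ≡ n C 2 + n
C2-suc n = begin
  suc n C 2        ≡⟨ sym (nCk+nC[k+1]≡[n+1]C[k+1] n 1) ⟩
  n C 1 + n C 2    ≡⟨ cong (_+ n C 2) (nC1≡n n) ⟩
  n + n C 2        ≡⟨ +-comm n (n C 2) ⟩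
  n C 2 + n        ∎

C2-positive : {n : ℕ} → 2 ≤ n → 1 ≤ n C 2
C2-positive {suc zero}    (s≤s ())
C2-positive {suc (suc k)} _ =
  subst (1 ≤_) (sym (C2-suc (suc k))) (≤-trans (s≤s z≤n) (m≤n+m (suc k) (suc k C 2)))

∸-cancelˡ-suc : {a b t : ℕ} → a ≤ t → b ≤ t → t ∸ a ≡ suc (t ∸ b) → b ≡ suc a
∸-cancelˡ-suc {a} {b} {t} a≤t b≤t eq = +-cancelˡ-≡ (t ∸ b) b (suc a) (begin
  t ∸ b + b          ≡⟨ m∸n+n≡m b≤t ⟩
  t                  ≡⟨ sym (m∸n+n≡m a≤t) ⟩
  t ∸ a + a          ≡⟨ cong (_+ a) eq ⟩
  suc (t ∸ b + a)    ≡⟨ sym (+-suc (t ∸ b) a) ⟩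
  t ∸ b + suc a      ∎)

module ℚ+ = CommutativeMonoid ℚP.+-0-commutativeMonoid

Σ-↭ : {A : Set} {xs ys : List A} (f : A → ℚ) → xs ↭ ys → Σ[ xs ] f ≡ Σ[ ys ] f
Σ-↭ {xs = xs} {ys} f xs↭ys = begin
  Σ[ xs ] f                   ≡⟨ sym (foldr-map ℚ._+_ f 0ℚ xs) ⟩
  foldr ℚ._+_ 0ℚ (map f xs)   ≡⟨ foldr-commMonoid ℚ+.setoid ℚ+.isCommutativeMonoid (↭⇒↭ₛ (map⁺ f xs↭ys)) ⟩
  foldr ℚ._+_ 0ℚ (map f ys)   ≡⟨ foldr-map ℚ._+_ f 0ℚ ys ⟩
  Σ[ ys ] f                   ∎

Σ-map : {A B : Set} (g : A → B) (xs : List A) (f : B → ℚ) → Σ[ map g xs ] f ≡ Σ[ xs ] (f ∘ g)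
Σ-map g xs f = foldr-map _ g 0ℚ xs

Σ-*ʳ : {A : Set} (xs : List A) (f : A → ℚ) (q : ℚ) → Σ[ xs ] (λ x → f x ℚ.* q) ≡ Σ[ xs ] f ℚ.* q
Σ-*ʳ []       f q = sym (ℚP.*-zeroˡ q)
Σ-*ʳ (x ∷ xs) f q = trans (cong (f x ℚ.* q ℚ.+_) (Σ-*ʳ xs f q)) (sym (ℚP.*-distribʳ-+ q (f x) _))

reverse-concatMap : {A B : Set} (g : A → List B) (xs : List A) →
                    reverse (concatMap g xs) ≡ concatMap (reverse ∘ g) (reverse xs)
reverse-concatMap g [] = refl
reverse-concatMap g (x ∷ xs) = begin
  reverse (g x List.++ concatMap g xs)
    ≡⟨ reverse-++ (g x) (concatMap g xs) ⟩
  reverse (concatMap g xs) List.++ reverse (g x)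
    ≡⟨ cong₂ List._++_ (reverse-concatMap g xs) (sym (++-identityʳ (reverse (g x)))) ⟩
  concatMap (reverse ∘ g) (reverse xs) List.++ concatMap (reverse ∘ g) [ x ]
    ≡⟨ sym (concatMap-++ (reverse ∘ g) (reverse xs) [ x ]) ⟩
  concatMap (reverse ∘ g) (reverse xs List.++ [ x ])
    ≡⟨ cong (concatMap (reverse ∘ g)) (sym (unfold-reverse x xs)) ⟩
  concatMap (reverse ∘ g) (reverse (x ∷ xs))
    ∎

map-filter-local : {A B : Set} {P : A → Set} {Q : B → Set} (P? : Decidable P) (Q? : Decidable Q)
                   (f : A → B) (xs : List A) →
                   (∀ {x} → x ∈ xs → (P x → Q (f x)) × (Q (f x) → P x)) →
                   map f (filter P? xs) ≡ filter Q? (map f xs)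
map-filter-local P? Q? f []       agree = refl
map-filter-local P? Q? f (x ∷ xs) agree with P? x | Q? (f x)
... | yes _  | yes _  = cong (f x ∷_) (map-filter-local P? Q? f xs (agree ∘ there))
... | no _   | no _   = map-filter-local P? Q? f xs (agree ∘ there)
... | yes px | no ¬qx = ⊥-elim (¬qx (proj₁ (agree (here refl)) px))
... | no ¬px | yes qx = ⊥-elim (¬px (proj₂ (agree (here refl)) qx))

∈-invSeqs⁺ : {n k : ℕ} {v : Vec ℕ n} → v ∈ invSeqs n → k ≤ n → v ∷ʳ k ∈ invSeqs (suc n)
∈-invSeqs⁺ {n} {k} {v} v∈ k≤n =
  ∈-concatMap⁺ (λ w → map (w ∷ʳ_) (upTo (suc n))) (lose v∈ (∈-map⁺ (v ∷ʳ_) (∈-upTo⁺ (s≤s k≤n))))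

∈-invSeqs⁻ : {n : ℕ} {x : Vec ℕ (suc n)} → x ∈ invSeqs (suc n) →
             ∃ λ v → ∃ λ k → v ∈ invSeqs n × k ≤ n × x ≡ v ∷ʳ k
∈-invSeqs⁻ {n} x∈ with find (∈-concatMap⁻ (λ v → map (v ∷ʳ_) (upTo (suc n))) {xs = invSeqs n} x∈)
... | v , v∈ , x∈row with ∈-map⁻ (v ∷ʳ_) x∈row
...   | k , k∈ , x≡ with ∈-upTo⁻ k∈
...     | s≤s k≤n = v , k , v∈ , k≤n , x≡

sum-∷ʳ : {n : ℕ} (v : Vec ℕ n) (k : ℕ) → Vec.sum (v ∷ʳ k) ≡ Vec.sum v + k
sum-∷ʳ []      k = +-identityʳ k
sum-∷ʳ (x ∷ v) k = trans (cong (x +_) (sum-∷ʳ v k)) (sym (+-assoc x (Vec.sum v) k))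

-- complementFrom o replaces the entry at (0-based) position i by (o + i) ∸ xᵢ;
-- the complement of an inversion sequence is complementFrom 0.
complementFrom : {n : ℕ} → ℕ → Vec ℕ n → Vec ℕ n
complementFrom o []       = []
complementFrom o (x ∷ xs) = (o ∸ x) ∷ complementFrom (suc o) xs

complement : {n : ℕ} → Vec ℕ n → Vec ℕ n
complement = complementFrom 0

lookup-complementFrom : {n : ℕ} (o : ℕ) (x : Vec ℕ n) (j : Fin n) →
                        lookup (complementFrom o x) j ≡ (o + toℕ j) ∸ lookup x j
lookup-complementFrom o (x ∷ xs) fzero    = cong (_∸ x) (sym (+-identityʳ o))
lookup-complementFrom o (x ∷ xs) (fsuc j) =
  trans (lookup-complementFrom (suc o) xs j) (cong (_∸ lookup xs j) (sym (+-suc o (toℕ j))))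

complementFrom-∷ʳ : {n : ℕ} (o : ℕ) (v : Vec ℕ n) (k : ℕ) →
                    complementFrom o (v ∷ʳ k) ≡ complementFrom o v ∷ʳ ((o + n) ∸ k)
complementFrom-∷ʳ o [] k = cong (λ t → (t ∸ k) ∷ []) (sym (+-identityʳ o))
complementFrom-∷ʳ {suc n} o (x ∷ v) k = cong ((o ∸ x) ∷_) (begin
  complementFrom (suc o) (v ∷ʳ k)                    ≡⟨ complementFrom-∷ʳ (suc o) v k ⟩
  complementFrom (suc o) v ∷ʳ (suc o + n ∸ k)        ≡⟨ cong (λ t → complementFrom (suc o) v ∷ʳ (t ∸ k)) (sym (+-suc o n)) ⟩
  complementFrom (suc o) v ∷ʳ (o + suc n ∸ k)        ∎)

complement-involutive : {n : ℕ} {x : Vec ℕ n} → x ∈ invSeqs n → complement (complement x) ≡ x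
complement-involutive {zero} {[]} _ = refl
complement-involutive {suc n} x∈ with ∈-invSeqs⁻ x∈
... | v , k , v∈ , k≤n , refl = begin
  complement (complement (v ∷ʳ k))           ≡⟨ cong complement (complementFrom-∷ʳ 0 v k) ⟩
  complement (complement v ∷ʳ (n ∸ k))       ≡⟨ complementFrom-∷ʳ 0 (complement v) (n ∸ k) ⟩
  complement (complement v) ∷ʳ (n ∸ (n ∸ k)) ≡⟨ cong₂ _∷ʳ_ (complement-involutive v∈) (m∸[m∸n]≡n k≤n) ⟩
  v ∷ʳ k                                      ∎

-- An inversion sequence and its complement together count every pair once.
sum-complement : {n : ℕ} {x : Vec ℕ n} → x ∈ invSeqs n → Vec.sum x + Vec.sum (complement x) ≡ n C 2
sum-complement {zero} {[]} _ = refl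
sum-complement {suc n} x∈ with ∈-invSeqs⁻ x∈
... | v , k , v∈ , k≤n , refl = begin
  Vec.sum (v ∷ʳ k) + Vec.sum (complement (v ∷ʳ k))
    ≡⟨ cong₂ _+_ (sum-∷ʳ v k) (trans (cong Vec.sum (complementFrom-∷ʳ 0 v k)) (sum-∷ʳ (complement v) (n ∸ k))) ⟩
  (Vec.sum v + k) + (Vec.sum (complement v) + (n ∸ k))
    ≡⟨ interchange (Vec.sum v) k (Vec.sum (complement v)) (n ∸ k) ⟩
  (Vec.sum v + Vec.sum (complement v)) + (k + (n ∸ k))
    ≡⟨ cong₂ _+_ (sum-complement v∈) (m+[n∸m]≡n k≤n) ⟩
  n C 2 + n
    ≡⟨ sym (C2-suc n) ⟩
  suc n C 2
    ∎

lookup-bound : {n : ℕ} {x : Vec ℕ n} → x ∈ invSeqs n → (j : Fin n) → lookup x j ≤ toℕ j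
lookup-bound {x = x} x∈ j =
  subst (_≤ toℕ j)
        (trans (sym (lookup-complementFrom 0 (complement x) j)) (cong (λ z → lookup z j) (complement-involutive x∈)))
        (m∸n≤m (toℕ j) (lookup (complement x) j))

complement-last : (n : ℕ) → map (n ∸_) (upTo (suc n)) ≡ reverse (upTo (suc n))
complement-last n = trans (reflect n) (sym (reverse-upTo (suc n)))
  where
  reflect : (n : ℕ) → map (n ∸_) (upTo (suc n)) ≡ downFrom (suc n)
  reflect zero    = refl
  reflect (suc n) = cong (suc n ∷_) (begin
    map (suc n ∸_) (List.applyUpTo suc (suc n))   ≡⟨ cong (map (suc n ∸_)) (sym (map-upTo suc (suc n))) ⟩
    map (suc n ∸_) (map suc (upTo (suc n)))       ≡⟨ sym (map-∘ (upTo (suc n))) ⟩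
    map (n ∸_) (upTo (suc n))                     ≡⟨ reflect n ⟩
    downFrom (suc n)                              ∎)

complement-reverses : (n : ℕ) → map complement (invSeqs n) ≡ reverse (invSeqs n)
complement-reverses zero    = refl
complement-reverses (suc n) = begin
  map complement (concatMap row (invSeqs n))       ≡⟨ map-concatMap complement row (invSeqs n) ⟩
  concatMap (map complement ∘ row) (invSeqs n)     ≡⟨ concatMap-cong complement-row (invSeqs n) ⟩
  concatMap (reverse ∘ row ∘ complement) (invSeqs n)
                                                   ≡⟨ sym (concatMap-map (reverse ∘ row) complement (invSeqs n)) ⟩
  concatMap (reverse ∘ row) (map complement (invSeqs n))
                                                   ≡⟨ cong (concatMap (reverse ∘ row)) (complement-reverses n) ⟩
  concatMap (reverse ∘ row) (reverse (invSeqs n))  ≡⟨ sym (reverse-concatMap row (invSeqs n)) ⟩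
  reverse (concatMap row (invSeqs n))              ∎
  where
  row : Vec ℕ n → List (Vec ℕ (suc n))
  row v = map (v ∷ʳ_) (upTo (suc n))
  complement-row : (v : Vec ℕ n) → map complement (row v) ≡ reverse (row (complement v))
  complement-row v = begin
    map complement (map (v ∷ʳ_) (upTo (suc n)))         ≡⟨ sym (map-∘ (upTo (suc n))) ⟩
    map (complement ∘ (v ∷ʳ_)) (upTo (suc n))           ≡⟨ map-cong (complementFrom-∷ʳ 0 v) (upTo (suc n)) ⟩
    map ((complement v ∷ʳ_) ∘ (n ∸_)) (upTo (suc n))    ≡⟨ map-∘ (upTo (suc n)) ⟩
    map (complement v ∷ʳ_) (map (n ∸_) (upTo (suc n)))  ≡⟨ cong (map (complement v ∷ʳ_)) (complement-last n) ⟩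
    map (complement v ∷ʳ_) (reverse (upTo (suc n)))     ≡⟨ reverse-map (complement v ∷ʳ_) (upTo (suc n)) ⟩
    reverse (row (complement v))                        ∎

𝒳⁺ : {n a : ℕ} {x : Vec ℕ n} → x ∈ invSeqs n → Vec.sum x ≡ a → x ∈ 𝒳 n a
𝒳⁺ {a = a} = ∈-filter⁺ (λ x → Vec.sum x ≟ a)

𝒳⁻ : {n a : ℕ} {x : Vec ℕ n} → x ∈ 𝒳 n a → x ∈ invSeqs n × Vec.sum x ≡ a
𝒳⁻ {a = a} = ∈-filter⁻ (λ x → Vec.sum x ≟ a)

complement-𝒳 : {n a b : ℕ} → a + b ≡ n C 2 → map complement (𝒳 n a) ↭ 𝒳 n b
complement-𝒳 {n} {a} {b} a+b =
  subst (_↭ 𝒳 n b) (sym image-as-filter) (filter-↭ (λ x → Vec.sum x ≟ b) (↭-reverse (invSeqs n)))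
  where
  levels-agree : ∀ {x} → x ∈ invSeqs n →
                 (Vec.sum x ≡ a → Vec.sum (complement x) ≡ b) × (Vec.sum (complement x) ≡ b → Vec.sum x ≡ a)
  levels-agree {x} x∈ =
      (λ { refl → +-cancelˡ-≡ (Vec.sum x) _ _ (trans (sum-complement x∈) (sym a+b)) })
    , (λ { refl → +-cancelˡ-≡ (Vec.sum (complement x)) _ _
                    (trans (trans (+-comm _ (Vec.sum x)) (sum-complement x∈)) (trans (sym a+b) (+-comm a _))) })
  image-as-filter : map complement (𝒳 n a) ≡ filter (λ x → Vec.sum x ≟ b) (reverse (invSeqs n))
  image-as-filter = begin
    map complement (filter (λ x → Vec.sum x ≟ a) (invSeqs n))
      ≡⟨ map-filter-local _ _ complement (invSeqs n) levels-agree ⟩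
    filter (λ x → Vec.sum x ≟ b) (map complement (invSeqs n))
      ≡⟨ cong (filter (λ x → Vec.sum x ≟ b)) (complement-reverses n) ⟩
    filter (λ x → Vec.sum x ≟ b) (reverse (invSeqs n))
      ∎

complement-∈𝒳 : {n a b : ℕ} {x : Vec ℕ n} → a + b ≡ n C 2 → x ∈ 𝒳 n a → complement x ∈ 𝒳 n b
complement-∈𝒳 a+b x∈ = ∈-resp-↭ (complement-𝒳 a+b) (∈-map⁺ complement x∈)

s-symmetric : {n a b : ℕ} → a + b ≡ n C 2 → s n a ≡ s n b
s-symmetric {n} {a} {b} a+b =
  trans (sym (length-map complement (𝒳 n a))) (↭-length (complement-𝒳 {n} {a} {b} a+b))

Σ-complement : {n a b : ℕ} → a + b ≡ n C 2 → (f : Vec ℕ n → ℚ) →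
               Σ[ 𝒳 n a ] (f ∘ complement) ≡ Σ[ 𝒳 n b ] f
Σ-complement {n} {a} a+b f = trans (sym (Σ-map complement (𝒳 n a) f)) (Σ-↭ f (complement-𝒳 a+b))

complement-Covers : {n : ℕ} {x y : Vec ℕ n} → x ∈ invSeqs n → y ∈ invSeqs n →
                    Covers (complement y) (complement x) → Covers x y
complement-Covers {x = x} {y} x∈ y∈ (j , raised , fixed) =
    j
  , ∸-cancelˡ-suc (lookup-bound x∈ j) (lookup-bound y∈ j)
      (trans (sym (lookup-complementFrom 0 x j)) (trans raised (cong suc (lookup-complementFrom 0 y j))))
  , λ i i≢j → sym (∸-cancelˡ-≡ (lookup-bound x∈ i) (lookup-bound y∈ i)
      (trans (sym (lookup-complementFrom 0 x i)) (trans (fixed i i≢j) (lookup-complementFrom 0 y i))))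

-- Every level 0 ≤ m ≤ C(n,2) is inhabited: extend a sequence of level
-- min(C(n-1,2), m) by the last entry m ∸ C(n-1,2) ≤ n-1.
𝒳-nonempty : (n : ℕ) {m : ℕ} → m ≤ n C 2 → ∃ λ x → x ∈ 𝒳 n m
𝒳-nonempty zero    z≤n = [] , here refl
𝒳-nonempty (suc n) {m} m≤ with 𝒳-nonempty n (m⊓n≤m (n C 2) m)
... | v , v∈ = v ∷ʳ (m ∸ n C 2) , 𝒳⁺ (∈-invSeqs⁺ (proj₁ (𝒳⁻ v∈)) last≤n) sum≡m
  where
  last≤n : m ∸ n C 2 ≤ n
  last≤n = subst (m ∸ n C 2 ≤_) (m+n∸m≡n (n C 2) n) (∸-monoˡ-≤ (n C 2) (subst (m ≤_) (C2-suc n) m≤))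
  sum≡m : Vec.sum (v ∷ʳ (m ∸ n C 2)) ≡ m
  sum≡m = begin
    Vec.sum (v ∷ʳ (m ∸ n C 2))     ≡⟨ sum-∷ʳ v (m ∸ n C 2) ⟩
    Vec.sum v + (m ∸ n C 2)        ≡⟨ cong (_+ (m ∸ n C 2)) (proj₂ (𝒳⁻ v∈)) ⟩
    (n C 2) ⊓ m + (m ∸ n C 2)      ≡⟨ m⊓n+n∸m≡n (n C 2) m ⟩
    m                              ∎

length-nonZero : {A : Set} {xs : List A} {x : A} → x ∈ xs → ℕ.NonZero (length xs)
length-nonZero {xs = _ ∷ _} _ = _

module Ratio (a b : ℕ) .{{b≢0 : ℕ.NonZero b}} where

  private instance
    ιb≢0 : ℚ.NonZero (ι b)
    ιb≢0 = ℚP.pos⇒nonZero (ι b) {{ℚP.normalize-pos b 1}}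

  ratio : ℚ
  ratio = ι a ℚ.* 1/ ι b

  *-ratio-nonNeg : {p : ℚ} → 0ℚ ℚ.≤ p → 0ℚ ℚ.≤ p ℚ.* ratio
  *-ratio-nonNeg {p} 0≤p =
    subst (ℚ._≤ p ℚ.* ratio) (ℚP.*-zeroˡ ratio) (ℚP.*-monoʳ-≤-nonNeg ratio {{ratio-nonNeg}} 0≤p)
    where
    ratio-nonNeg : ℚ.NonNegative ratio
    ratio-nonNeg = ℚP.nonNeg*nonNeg⇒nonNeg (ι a) {{ℚP.normalize-nonNeg a 1}} (1/ ι b)
                     {{ℚP.pos⇒nonNeg (1/ ι b) {{ℚP.1/pos⇒pos (ι b) {{ℚP.normalize-pos b 1}}}}}}

  *-ratio-inverse : {p : ℚ} → p ℚ.* ι a ≡ ι b → p ℚ.* ratio ≡ 1ℚ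
  *-ratio-inverse {p} pa≡b = begin
    p ℚ.* (ι a ℚ.* 1/ ι b)     ≡⟨ sym (ℚP.*-assoc p (ι a) (1/ ι b)) ⟩
    (p ℚ.* ι a) ℚ.* 1/ ι b     ≡⟨ cong (ℚ._* 1/ ι b) pa≡b ⟩
    ι b ℚ.* 1/ ι b             ≡⟨ ℚP.*-inverseʳ (ι b) ⟩
    1ℚ                         ∎

  ratio-*-denominator : ratio ℚ.* ι b ≡ ι a
  ratio-*-denominator = begin
    (ι a ℚ.* 1/ ι b) ℚ.* ι b   ≡⟨ ℚP.*-assoc (ι a) (1/ ι b) (ι b) ⟩
    ι a ℚ.* (1/ ι b ℚ.* ι b)   ≡⟨ cong (ι a ℚ.*_) (ℚP.*-inverseˡ (ι b)) ⟩
    ι a ℚ.* 1ℚ                 ≡⟨ ℚP.*-identityʳ (ι a) ⟩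
    ι a                        ∎

transition-duality : {n m m̃ : ℕ} → m̃ + suc m ≡ n C 2 → HasTransition n m → HasTransition n m̃
transition-duality {n} {m} {m̃} balance (ρ , nonNeg , rowSum , colSum , support) =
  ρ̃ , nonNeg̃ , rowSum̃ , colSum̃ , support̃
  where
  balance′ : suc m̃ + m ≡ n C 2
  balance′ = trans (sym (+-suc m̃ m)) balance

  row-complement : ∀ {x} → x ∈ 𝒳 n m̃ → complement x ∈ 𝒳 n (suc m)
  row-complement = complement-∈𝒳 {n} {m̃} {suc m} balance

  column-complement : ∀ {y} → y ∈ 𝒳 n (suc m̃) → complement y ∈ 𝒳 n m
  column-complement = complement-∈𝒳 {n} {suc m̃} {m} balance′

  instance
    s≢0 : ℕ.NonZero (s n m)
    s≢0 = length-nonZero (proj₂ (𝒳-nonempty n (subst (m ≤_) balance (≤-trans (n≤1+n m) (m≤n+m (suc m) m̃)))))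

  open Ratio (s n (suc m)) (s n m)

  ρ̃ : Vec ℕ n → Vec ℕ n → ℚ
  ρ̃ x y = ρ (complement y) (complement x) ℚ.* ratio

  nonNeg̃ : ∀ x y → x ∈ 𝒳 n m̃ → y ∈ 𝒳 n (suc m̃) → 0ℚ ℚ.≤ ρ̃ x y
  nonNeg̃ x y x∈ y∈ = *-ratio-nonNeg (nonNeg _ _ (column-complement y∈) (row-complement x∈))

  rowSum̃ : ∀ x → x ∈ 𝒳 n m̃ → Σ[ 𝒳 n (suc m̃) ] (λ y → ρ̃ x y) ≡ 1ℚ
  rowSum̃ x x∈ = begin
    Σ[ 𝒳 n (suc m̃) ] (λ y → ρ (complement y) x̄ ℚ.* ratio)  ≡⟨ Σ-complement {n} {suc m̃} {m} balance′ (λ z → ρ z x̄ ℚ.* ratio) ⟩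
    Σ[ 𝒳 n m ] (λ z → ρ z x̄ ℚ.* ratio)                     ≡⟨ Σ-*ʳ (𝒳 n m) (λ z → ρ z x̄) ratio ⟩
    Σ[ 𝒳 n m ] (λ z → ρ z x̄) ℚ.* ratio                     ≡⟨ *-ratio-inverse {Σ[ 𝒳 n m ] (λ z → ρ z x̄)} (colSum x̄ (row-complement x∈)) ⟩
    1ℚ                                                      ∎
    where x̄ = complement x

  colSum̃ : ∀ y → y ∈ 𝒳 n (suc m̃) → Σ[ 𝒳 n m̃ ] (λ x → ρ̃ x y) ℚ.* ι (s n (suc m̃)) ≡ ι (s n m̃)
  colSum̃ y y∈ = begin
    Σ[ 𝒳 n m̃ ] (λ x → ρ̃ x y) ℚ.* ι (s n (suc m̃))  ≡⟨ cong₂ ℚ._*_ column (cong ι (s-symmetric {n} {suc m̃} {m} balance′)) ⟩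
    ratio ℚ.* ι (s n m)                           ≡⟨ ratio-*-denominator ⟩
    ι (s n (suc m))                               ≡⟨ cong ι (sym (s-symmetric {n} {m̃} {suc m} balance)) ⟩
    ι (s n m̃)                                     ∎
    where
    ȳ = complement y
    column : Σ[ 𝒳 n m̃ ] (λ x → ρ ȳ (complement x) ℚ.* ratio) ≡ ratio
    column = begin
      Σ[ 𝒳 n m̃ ] (λ x → ρ ȳ (complement x) ℚ.* ratio)  ≡⟨ Σ-complement {n} {m̃} {suc m} balance (λ z → ρ ȳ z ℚ.* ratio) ⟩
      Σ[ 𝒳 n (suc m) ] (λ z → ρ ȳ z ℚ.* ratio)         ≡⟨ Σ-*ʳ (𝒳 n (suc m)) (ρ ȳ) ratio ⟩
      Σ[ 𝒳 n (suc m) ] (ρ ȳ) ℚ.* ratio                 ≡⟨ cong (ℚ._* ratio) (rowSum ȳ (column-complement y∈)) ⟩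
      1ℚ ℚ.* ratio                                      ≡⟨ ℚP.*-identityˡ ratio ⟩
      ratio                                             ∎

  support̃ : ∀ x y → x ∈ 𝒳 n m̃ → y ∈ 𝒳 n (suc m̃) → ¬ Covers x y → ρ̃ x y ≡ 0ℚ
  support̃ x y x∈ y∈ ¬x⋖y = begin
    ρ (complement y) (complement x) ℚ.* ratio  ≡⟨ cong (ℚ._* ratio) (support _ _ ȳ∈ x̄∈ (¬x⋖y ∘ complement-Covers x∈I y∈I)) ⟩
    0ℚ ℚ.* ratio                               ≡⟨ ℚP.*-zeroˡ ratio ⟩
    0ℚ                                         ∎
    where
    x∈I = proj₁ (𝒳⁻ x∈)
    y∈I = proj₁ (𝒳⁻ y∈)
    x̄∈ = row-complement x∈
    ȳ∈ = column-complement y∈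

lemma2p2 : (n m : ℕ) → 2 ≤ n → m ≤ (n C 2) ∸ 1 → HasTransition n m → HasTransition n ((n C 2) ∸ 1 ∸ m)
lemma2p2 n m 2≤n m≤ = transition-duality balance
  where
  balance : (n C 2) ∸ 1 ∸ m + suc m ≡ n C 2
  balance = begin
    (n C 2) ∸ 1 ∸ m + suc m       ≡⟨ +-suc ((n C 2) ∸ 1 ∸ m) m ⟩
    suc ((n C 2) ∸ 1 ∸ m + m)     ≡⟨ cong suc (m∸n+n≡m m≤) ⟩
    suc ((n C 2) ∸ 1)             ≡⟨ m+[n∸m]≡n (C2-positive 2≤n) ⟩
    n C 2                         ∎
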